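{- Let \[E(n,k,\ell)=\sum_{\substack{i_0+i_1+\cdots+i_k=n\\ j_0+j_1+\cdots+j_k=\ell}}\prod_{t=0}^kN(i_t,j_t+1),\] where the sum ranges over all compositions $(i_0,i_1,\ldots,i_k)$ of $n$ and all weak compositions $(j_0,j_1,\ldots,j_k)$ of $\ell$. Then $E(n,k,\ell)=N_k(n,\ell+1)$.
   Context: $N(i,j)=\frac1i\binom ij\binom i{j-1}$ is the Narayana number, and the generalized Narayana numbers are $N_k(n,r)=\frac{k+1}{n}{n\choose r+k}{n\choose r-1}$ (so $N_0=N$). -}

module Defs where

open import Data.Nat using (ℕ; zero; suc; _∸_; NonZero) renaming (_*_ to _*ℕ_; _+_ to _+ℕ_)
open import Data.Nat.Combinatorics using (_C_)
open import Data.Integer using (+_)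
open import Data.Rational using (ℚ; 0ℚ; 1ℚ; _/_; _+_; _*_)
open import Data.List using (List; []; _∷_; map; concatMap; upTo; foldr; zipWith)

-- Narayana number N(i,j) = (1/i) C(i,j) C(i,j-1), as a rational.
-- Conventions: C(i,-1) = 0, so N(i,0) = 0; N(0,j) = 0 is never used
-- (all parts of a composition are ≥ 1).
N : ℕ → ℕ → ℚ
N zero    _       = 0ℚ
N (suc i) zero    = 0ℚ
N (suc i) (suc j) = + ((suc i C suc j) *ℕ (suc i C j)) / suc i

-- Generalized Narayana number N_k(n,r) = (k+1)/n C(n,r+k) C(n,r-1)
-- (with C(n,-1) = 0).
Nk : ℕ → (n : ℕ) → .{{NonZero n}} → ℕ → ℚ
Nk k n zero    = 0ℚ
Nk k n (suc r) = + ((suc k) *ℕ (n C (suc r +ℕ k)) *ℕ (n C r)) / n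

compositions : ℕ → ℕ → List (List ℕ)
compositions zero    zero    = [] ∷ []
compositions zero    (suc _) = []
compositions (suc p) n =
  concatMap (λ i → map (i ∷_) (compositions p (n ∸ i))) (map suc (upTo n))

weakCompositions : ℕ → ℕ → List (List ℕ)
weakCompositions zero    zero    = [] ∷ []
weakCompositions zero    (suc _) = []
weakCompositions (suc p) n =
  concatMap (λ j → map (j ∷_) (weakCompositions p (n ∸ j))) (upTo (suc n))

sumℚ : List ℚ → ℚ
sumℚ = foldr _+_ 0ℚ

prodℚ : List ℚ → ℚ
prodℚ = foldr _*_ 1ℚ

E : ℕ → ℕ → ℕ → ℚ
E n k ℓ = sumℚ (concatMap (λ is → map (λ js → prodℚ (zipWith (λ i j → N i (suc j)) is js))
                                      (weakCompositions (suc k) ℓ))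
                          (compositions (suc k) n))

module Submission where

-- Let F(x,y) be the Narayana series Σ N(i,j+1) xⁱ yʲ; it satisfies
-- F = x (1 + F) (1 + y F).  The double sum E(n,k,ℓ) is the coefficient of
-- xⁿ yˡ in F^(k+1), and the generalized Narayana number is its closed form.
--
-- We never manipulate formal power series directly.  Instead, the
-- coefficients of all powers Fᵃ are defined at once by the recurrence
-- obtained from multiplying the functional equation by Fᵃ, and we prove:
--   * Fᵃ ⊛ Fᵇ = F^(a+b) for the bivariate Cauchy product ⊛ (induction on
--     the x-degree, using that ⊛ is linear and commutes with multiplication
--     by y);
--   * the closed form n·[xⁿyˡ]Fᵐ = m·C(n,l)·C(n,m+l) for n ≥ 1 (induction
--     on n, using Pascal's rule and the absorption identity);
--   * the sum over (weak) compositions in E, read in ℕ, is an iterated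
--     Cauchy product of F, hence equals [xⁿyˡ]F^(k+1).

open import Data.Nat using (ℕ; zero; suc; NonZero; _+_; _*_; _∸_)
open import Data.Nat.Properties
  using (+-identityʳ; *-identityˡ; *-comm; *-zeroʳ; *-distribˡ-+; *-distribʳ-+; +-suc; +-comm; *-cancelˡ-≡; +-cancelʳ-≡; +-commutativeSemigroup)
open import Algebra.Properties.CommutativeSemigroup +-commutativeSemigroup using (interchange)
open import Data.Nat.Tactic.RingSolver using (solve-∀; solve)
open import Data.Nat.Combinatorics using (_C_; nCk+nC[k+1]≡[n+1]C[k+1])
open import Data.List using (List; []; _∷_; map; concatMap; upTo; applyUpTo; zipWith)
open import Data.List.Properties using (map-cong; map-∘; map-concatMap; concatMap-cong)
open import Data.Nat.ListAction using (sum; product)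
open import Data.Nat.ListAction.Properties using (sum-++)
open import Data.Integer as ℤ using () renaming (+_ to pos)
open import Data.Integer.Properties using (pos-+; pos-*)
import Data.Integer.Tactic.RingSolver as ℤ-Solver
open import Data.Rational as ℚ using (ℚ; _/_; toℚᵘ)
open import Data.Rational.Properties using (toℚᵘ-injective; toℚᵘ-fromℚᵘ; toℚᵘ-homo-+; toℚᵘ-homo-*; fromℚᵘ-cong)
open import Data.Rational.Unnormalised as ℚᵘ using (ℚᵘ; mkℚᵘ; *≡*; _≃_)
import Data.Rational.Unnormalised.Properties as ℚᵘ
open import Defs
open import Function using (_∘_)
open import Relation.Binary.PropositionalEquality

-- The embedding ℕ → ℚ used by the definitions (t ↦ t/1), and its
-- unnormalised counterpart, through which its arithmetic is checked.
ι : ℕ → ℚ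
ι t = pos t / 1

ιᵘ : ℕ → ℚᵘ
ιᵘ t = mkℚᵘ (pos t) 0

toℚᵘ-ι : ∀ t → toℚᵘ (ι t) ≃ ιᵘ t
toℚᵘ-ι t = toℚᵘ-fromℚᵘ (ιᵘ t)

ι-+ : ∀ a b → ι (a + b) ≡ ι a ℚ.+ ι b
ι-+ a b = toℚᵘ-injective (begin
  toℚᵘ (ι (a + b))              ≈⟨ toℚᵘ-ι (a + b) ⟩
  ιᵘ (a + b)                    ≈⟨ *≡* (trans (cong (ℤ._* pos 1) (pos-+ a b)) (ℤ-identity (pos a) (pos b))) ⟩
  ιᵘ a ℚᵘ.+ ιᵘ b                ≈⟨ ℚᵘ.+-cong (toℚᵘ-ι a) (toℚᵘ-ι b) ⟨
  toℚᵘ (ι a) ℚᵘ.+ toℚᵘ (ι b)    ≈⟨ toℚᵘ-homo-+ (ι a) (ι b) ⟨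
  toℚᵘ (ι a ℚ.+ ι b)            ∎)
  where
  open ℚᵘ.≃-Reasoning
  ℤ-identity : ∀ x y → (x ℤ.+ y) ℤ.* pos 1 ≡ (x ℤ.* pos 1 ℤ.+ y ℤ.* pos 1) ℤ.* pos 1
  ℤ-identity = ℤ-Solver.solve-∀

ι-* : ∀ a b → ι (a * b) ≡ ι a ℚ.* ι b
ι-* a b = toℚᵘ-injective (begin
  toℚᵘ (ι (a * b))              ≈⟨ toℚᵘ-ι (a * b) ⟩
  ιᵘ (a * b)                    ≈⟨ *≡* (cong (ℤ._* pos 1) (pos-* a b)) ⟩
  ιᵘ a ℚᵘ.* ιᵘ b                ≈⟨ ℚᵘ.*-cong (toℚᵘ-ι a) (toℚᵘ-ι b) ⟨
  toℚᵘ (ι a) ℚᵘ.* toℚᵘ (ι b)    ≈⟨ toℚᵘ-homo-* (ι a) (ι b) ⟨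
  toℚᵘ (ι a ℚ.* ι b)            ∎)
  where open ℚᵘ.≃-Reasoning

ι-sum : ∀ xs → sumℚ (map ι xs) ≡ ι (sum xs)
ι-sum []       = refl
ι-sum (x ∷ xs) = trans (cong (ι x ℚ.+_) (ι-sum xs)) (sym (ι-+ x (sum xs)))

ι-/ : ∀ d t x → x ≡ suc d * t → pos x / suc d ≡ ι t
ι-/ d t x refl = fromℚᵘ-cong {mkℚᵘ (pos (suc d * t)) d} {ιᵘ t}
  (*≡* (trans (cong (ℤ._* pos 1) (pos-* (suc d) t)) (ℤ-identity (pos (suc d)) (pos t))))
  where
  ℤ-identity : ∀ x y → (x ℤ.* y) ℤ.* pos 1 ≡ y ℤ.* x
  ℤ-identity = ℤ-Solver.solve-∀

open ≡-Reasoning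

-- Σ_{i<n} f(i), unfolded at the bottom so that induction on n shifts f.
Σ< : ℕ → (ℕ → ℕ) → ℕ
Σ< zero    f = 0
Σ< (suc n) f = f 0 + Σ< n (f ∘ suc)

Σ<-cong : ∀ n {f g : ℕ → ℕ} → (∀ i → f i ≡ g i) → Σ< n f ≡ Σ< n g
Σ<-cong zero    eq = refl
Σ<-cong (suc n) eq = cong₂ _+_ (eq 0) (Σ<-cong n (eq ∘ suc))

Σ<-zero : ∀ n → Σ< n (λ _ → 0) ≡ 0
Σ<-zero zero    = refl
Σ<-zero (suc n) = Σ<-zero n

Σ<-+ : ∀ n (f g : ℕ → ℕ) → Σ< n (λ i → f i + g i) ≡ Σ< n f + Σ< n g
Σ<-+ zero    f g = refl
Σ<-+ (suc n) f g = begin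
  (f 0 + g 0) + Σ< n (λ i → f (suc i) + g (suc i))  ≡⟨ cong (f 0 + g 0 +_) (Σ<-+ n (f ∘ suc) (g ∘ suc)) ⟩
  (f 0 + g 0) + (Σ< n (f ∘ suc) + Σ< n (g ∘ suc))   ≡⟨ interchange (f 0) (g 0) _ _ ⟩
  (f 0 + Σ< n (f ∘ suc)) + (g 0 + Σ< n (g ∘ suc))   ∎

-- Univariate series in y are functions ℕ → ℕ (coefficient of yˡ).
-- Multiplication by y:  (y·h)_0 = 0,  (y·h)_(l+1) = h_l.
y· : (ℕ → ℕ) → ℕ → ℕ
y· h zero    = 0
y· h (suc l) = h l

y·-cong : ∀ {h h' : ℕ → ℕ} l → (∀ j → h j ≡ h' j) → y· h l ≡ y· h' l
y·-cong zero    eq = refl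
y·-cong (suc l) eq = eq l

y·-+ : ∀ (u v : ℕ → ℕ) l → y· (λ j → u j + v j) l ≡ y· u l + y· v l
y·-+ u v zero    = refl
y·-+ u v (suc l) = refl

Σ<-y· : ∀ n (h : ℕ → ℕ → ℕ) l → Σ< n (λ i → y· (h i) l) ≡ y· (λ j → Σ< n (λ i → h i j)) l
Σ<-y· n h zero    = Σ<-zero n
Σ<-y· n h (suc l) = refl

_⋆_ : (ℕ → ℕ) → (ℕ → ℕ) → ℕ → ℕ
(f ⋆ g) l = Σ< (suc l) (λ j → f j * g (l ∸ j))

⋆-zeroˡ : ∀ g l → ((λ _ → 0) ⋆ g) l ≡ 0
⋆-zeroˡ g l = Σ<-zero (suc l)

⋆-congʳ : ∀ f {g g' : ℕ → ℕ} l → (∀ j → g j ≡ g' j) → (f ⋆ g) l ≡ (f ⋆ g') l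
⋆-congʳ f l eq = Σ<-cong (suc l) (λ j → cong (f j *_) (eq (l ∸ j)))

⋆-distribʳ-+ : ∀ (f f' g : ℕ → ℕ) l → ((λ j → f j + f' j) ⋆ g) l ≡ (f ⋆ g) l + (f' ⋆ g) l
⋆-distribʳ-+ f f' g l =
  trans (Σ<-cong (suc l) (λ j → *-distribʳ-+ (g (l ∸ j)) (f j) (f' j)))
        (Σ<-+ (suc l) (λ j → f j * g (l ∸ j)) (λ j → f' j * g (l ∸ j)))

⋆-y· : ∀ (h g : ℕ → ℕ) l → (y· h ⋆ g) l ≡ y· (h ⋆ g) l
⋆-y· h g zero    = refl
⋆-y· h g (suc l) = refl

-- Bivariate series are functions ℕ → ℕ → ℕ, f n l = [xⁿ yˡ] f, and their
-- Cauchy product sums univariate Cauchy products over the x-degree.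
Series : Set
Series = ℕ → ℕ → ℕ

_⊛_ : Series → Series → Series
(f ⊛ g) n l = Σ< (suc n) (λ i → (f i ⋆ g (n ∸ i)) l)

⊛-congʳ : ∀ f {g g' : Series} n l → (∀ m j → g m j ≡ g' m j) → (f ⊛ g) n l ≡ (f ⊛ g') n l
⊛-congʳ f n l eq = Σ<-cong (suc n) (λ i → ⋆-congʳ (f i) l (eq (n ∸ i)))

-- The shape of the recurrence for powers of F:  u + v + y·(w + z).
rec : (ℕ → ℕ) → (ℕ → ℕ) → (ℕ → ℕ) → (ℕ → ℕ) → ℕ → ℕ
rec u v w z l = (u l + v l) + y· (λ j → w j + z j) l

rec-cong : ∀ {u u' v v' w w' z z' : ℕ → ℕ} l →
           (∀ j → u j ≡ u' j) → (∀ j → v j ≡ v' j) → (∀ j → w j ≡ w' j) → (∀ j → z j ≡ z' j) →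
           rec u v w z l ≡ rec u' v' w' z' l
rec-cong l eu ev ew ez = cong₂ _+_ (cong₂ _+_ (eu l) (ev l)) (y·-cong l (λ j → cong₂ _+_ (ew j) (ez j)))

-- Both the Cauchy product and finite sums are linear and commute with y·,
-- so they pass through the recurrence.
⋆-rec : ∀ (u v w z g : ℕ → ℕ) l → (rec u v w z ⋆ g) l ≡ rec (u ⋆ g) (v ⋆ g) (w ⋆ g) (z ⋆ g) l
⋆-rec u v w z g l = begin
  (rec u v w z ⋆ g) l
    ≡⟨ ⋆-distribʳ-+ (λ j → u j + v j) (y· (λ j → w j + z j)) g l ⟩
  ((λ j → u j + v j) ⋆ g) l + (y· (λ j → w j + z j) ⋆ g) l
    ≡⟨ cong₂ _+_ (⋆-distribʳ-+ u v g l) (⋆-y· (λ j → w j + z j) g l) ⟩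
  ((u ⋆ g) l + (v ⋆ g) l) + y· ((λ j → w j + z j) ⋆ g) l
    ≡⟨ cong ((u ⋆ g) l + (v ⋆ g) l +_) (y·-cong l (⋆-distribʳ-+ w z g)) ⟩
  rec (u ⋆ g) (v ⋆ g) (w ⋆ g) (z ⋆ g) l ∎

Σ<-rec : ∀ n (u v w z : ℕ → ℕ → ℕ) l →
         Σ< n (λ i → rec (u i) (v i) (w i) (z i) l)
           ≡ rec (λ j → Σ< n (λ i → u i j)) (λ j → Σ< n (λ i → v i j))
                 (λ j → Σ< n (λ i → w i j)) (λ j → Σ< n (λ i → z i j)) l
Σ<-rec n u v w z l = begin
  Σ< n (λ i → rec (u i) (v i) (w i) (z i) l)
    ≡⟨ Σ<-+ n (λ i → u i l + v i l) (λ i → y· (λ j → w i j + z i j) l) ⟩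
  Σ< n (λ i → u i l + v i l) + Σ< n (λ i → y· (λ j → w i j + z i j) l)
    ≡⟨ cong₂ _+_ (Σ<-+ n (λ i → u i l) (λ i → v i l)) (Σ<-y· n (λ i j → w i j + z i j) l) ⟩
  (Σ< n (λ i → u i l) + Σ< n (λ i → v i l)) + y· (λ j → Σ< n (λ i → w i j + z i j)) l
    ≡⟨ cong (Σ< n (λ i → u i l) + Σ< n (λ i → v i l) +_) (y·-cong l (λ j → Σ<-+ n (λ i → w i j) (λ i → z i j))) ⟩
  rec (λ j → Σ< n (λ i → u i j)) (λ j → Σ< n (λ i → v i j))
      (λ j → Σ< n (λ i → w i j)) (λ j → Σ< n (λ i → z i j)) l ∎

-- Fpow a = Fᵃ, where F = x(1 + F)(1 + yF) is the Narayana series.  Multiplying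
-- the functional equation by Fᵃ gives F^(a+1) = x·(Fᵃ + F^(a+1) + y(F^(a+1) + F^(a+2))),
-- which determines all coefficients by recursion on the x-degree.
Fpow : ℕ → Series
Fpow zero    zero    zero    = 1
Fpow zero    zero    (suc l) = 0
Fpow zero    (suc n) l       = 0
Fpow (suc a) zero    l       = 0
Fpow (suc a) (suc n) l       = rec (Fpow a n) (Fpow (suc a) n) (Fpow (suc a) n) (Fpow (suc (suc a)) n) l

Fpow-zero-⊛ : ∀ (g : Series) n l → (Fpow 0 ⊛ g) n l ≡ g n l
Fpow-zero-⊛ g n l = begin
  (Fpow 0 0 ⋆ g n) l + Σ< n (λ i → (Fpow 0 (suc i) ⋆ g (n ∸ suc i)) l)
    ≡⟨ cong ((Fpow 0 0 ⋆ g n) l +_) (trans (Σ<-cong n (λ i → ⋆-zeroˡ (g (n ∸ suc i)) l)) (Σ<-zero n)) ⟩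
  (Fpow 0 0 ⋆ g n) l + 0
    ≡⟨ +-identityʳ _ ⟩
  (g n l + 0) + Σ< l (λ _ → 0)
    ≡⟨ cong₂ _+_ (+-identityʳ _) (Σ<-zero l) ⟩
  g n l + 0
    ≡⟨ +-identityʳ _ ⟩
  g n l ∎

Fpow-⊛ : ∀ a b n l → (Fpow a ⊛ Fpow b) n l ≡ Fpow (a + b) n l
Fpow-⊛ zero    b n       l = Fpow-zero-⊛ (Fpow b) n l
Fpow-⊛ (suc a) b zero    l = trans (+-identityʳ _) (⋆-zeroˡ (Fpow b 0) l)
Fpow-⊛ (suc a) b (suc n) l = begin
  (Fpow (suc a) 0 ⋆ Fpow b (suc n)) l + Σ< (suc n) (λ i → (Fpow (suc a) (suc i) ⋆ Fpow b (n ∸ i)) l)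
    ≡⟨ cong (_+ Σ< (suc n) (λ i → (Fpow (suc a) (suc i) ⋆ Fpow b (n ∸ i)) l)) (⋆-zeroˡ (Fpow b (suc n)) l) ⟩
  Σ< (suc n) (λ i → (Fpow (suc a) (suc i) ⋆ Fpow b (n ∸ i)) l)
    ≡⟨ Σ<-cong (suc n) (λ i → ⋆-rec (Fpow a i) (Fpow (suc a) i) (Fpow (suc a) i) (Fpow (suc (suc a)) i) (Fpow b (n ∸ i)) l) ⟩
  Σ< (suc n) (λ i → rec (Fpow a i ⋆ G i) (Fpow (suc a) i ⋆ G i) (Fpow (suc a) i ⋆ G i) (Fpow (suc (suc a)) i ⋆ G i) l)
    ≡⟨ Σ<-rec (suc n) (λ i → Fpow a i ⋆ G i) (λ i → Fpow (suc a) i ⋆ G i)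
                      (λ i → Fpow (suc a) i ⋆ G i) (λ i → Fpow (suc (suc a)) i ⋆ G i) l ⟩
  rec ((Fpow a ⊛ Fpow b) n) ((Fpow (suc a) ⊛ Fpow b) n) ((Fpow (suc a) ⊛ Fpow b) n) ((Fpow (suc (suc a)) ⊛ Fpow b) n) l
    ≡⟨ rec-cong l (Fpow-⊛ a b n) (Fpow-⊛ (suc a) b n) (Fpow-⊛ (suc a) b n) (Fpow-⊛ (suc (suc a)) b n) ⟩
  Fpow (suc a + b) (suc n) l ∎
  where
  G : ℕ → ℕ → ℕ
  G i = Fpow b (n ∸ i)

-- Binomial coefficients by Pascal's rule; they agree with the library's _C_
-- but compute by pattern matching.
binom : ℕ → ℕ → ℕ
binom zero    zero    = 1
binom zero    (suc k) = 0
binom (suc n) zero    = 1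
binom (suc n) (suc k) = binom n k + binom n (suc k)

binom≡C : ∀ n k → binom n k ≡ n C k
binom≡C zero    zero    = refl
binom≡C zero    (suc k) = refl
binom≡C (suc n) zero    = refl
binom≡C (suc n) (suc k) = trans (cong₂ _+_ (binom≡C n k) (binom≡C n (suc k))) (nCk+nC[k+1]≡[n+1]C[k+1] n k)

pascal : ∀ n l → binom (suc n) l ≡ y· (binom n) l + binom n l
pascal zero    zero    = refl
pascal (suc n) zero    = refl
pascal n       (suc l) = refl

absorption : ∀ n l → l * binom (suc n) l ≡ suc n * y· (binom n) l
absorption n       zero          = sym (*-zeroʳ (suc n))
absorption zero    (suc zero)    = refl
absorption zero    (suc (suc k)) = *-zeroʳ (suc (suc k))
absorption (suc n) (suc k)       = begin
  suc k * (binom (suc n) k + binom (suc n) (suc k))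
    ≡⟨ expand k b b' ⟩
  b + (k * b + suc k * b')
    ≡⟨ cong (b +_) (cong₂ _+_ (absorption n k) (absorption n (suc k))) ⟩
  b + (suc n * y· (binom n) k + suc n * binom n k)
    ≡⟨ cong (b +_) (sym (*-distribˡ-+ (suc n) (y· (binom n) k) (binom n k))) ⟩
  b + suc n * (y· (binom n) k + binom n k)
    ≡⟨ cong (λ t → b + suc n * t) (sym (pascal n k)) ⟩
  suc (suc n) * binom (suc n) k ∎
  where
  b b' : ℕ
  b  = binom (suc n) k
  b' = binom (suc n) (suc k)
  expand : ∀ k x y → suc k * (x + y) ≡ x + (k * x + suc k * y)
  expand = solve-∀

-- The polynomial identity behind the induction step of the closed form.
-- With s = a + b, u = c + d and N = n + 1, the two hypotheses (instances of
-- absorption) give  (p+1)·s·u + N·a·d = N·b·c,  which rearranges to the goal.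
closedForm-step : ∀ n p l a b c d → l * (a + b) ≡ suc n * a → (suc p + l) * (c + d) ≡ suc n * c →
                  suc n * ((p * b * c + suc p * b * d) + (suc p * a * c + suc (suc p) * a * d))
                    ≡ n * (suc p * (a + b) * (c + d))
closedForm-step n p l a b c d ls≡Na [p+1+l]u≡Nc = +-cancelʳ-≡ (suc n * b * c) _ _ (begin
  suc n * ((p * b * c + suc p * b * d) + (suc p * a * c + suc (suc p) * a * d)) + suc n * b * c
    ≡⟨ solve (n ∷ p ∷ a ∷ b ∷ c ∷ d ∷ []) ⟩
  n * (suc p * (a + b) * (c + d)) + (suc p * (a + b) * (c + d) + suc n * a * d)
    ≡⟨ cong (n * (suc p * (a + b) * (c + d)) +_) key ⟩
  n * (suc p * (a + b) * (c + d)) + suc n * b * c ∎)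
  where
  key : suc p * (a + b) * (c + d) + suc n * a * d ≡ suc n * b * c
  key = +-cancelʳ-≡ (suc n * a * c) _ _ (begin
    suc p * (a + b) * (c + d) + suc n * a * d + suc n * a * c
      ≡⟨ solve (n ∷ p ∷ a ∷ b ∷ c ∷ d ∷ []) ⟩
    suc p * (a + b) * (c + d) + suc n * a * (c + d)
      ≡⟨ cong (λ t → suc p * (a + b) * (c + d) + t * (c + d)) (sym ls≡Na) ⟩
    suc p * (a + b) * (c + d) + l * (a + b) * (c + d)
      ≡⟨ solve (p ∷ l ∷ a ∷ b ∷ c ∷ d ∷ []) ⟩
    (a + b) * ((suc p + l) * (c + d))
      ≡⟨ cong ((a + b) *_) [p+1+l]u≡Nc ⟩
    (a + b) * (suc n * c)
      ≡⟨ solve (n ∷ a ∷ b ∷ c ∷ []) ⟩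
    suc n * b * c + suc n * a * c ∎)

-- Closed form of the coefficients of Fᵐ (as given by Lagrange inversion):
-- n·[xⁿyˡ]Fᵐ = m·C(n,l)·C(n,m+l) for n ≥ 1.  The induction step feeds the
-- recurrence for Fpow through the induction hypothesis, Pascal's rule and
-- absorption; multiplying by n first keeps everything in ℕ.  For n = 1 the
-- coefficient [x yˡ]Fᵐ is 1 if m = 1 and l = 0, and 0 otherwise.
Fpow-closed : ∀ n m l → suc n * Fpow m (suc n) l ≡ m * binom (suc n) l * binom (suc n) (m + l)
Fpow-closed zero    zero          l       = refl
Fpow-closed zero    (suc zero)    zero    = refl
Fpow-closed zero    (suc zero)    (suc l) = sym (*-zeroʳ (1 * binom 1 (suc l)))
Fpow-closed zero    (suc (suc p)) zero    = sym (*-zeroʳ (suc (suc p) * 1))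
Fpow-closed zero    (suc (suc p)) (suc l) = sym (*-zeroʳ (suc (suc p) * binom 1 (suc l)))
Fpow-closed (suc n) zero          l       = *-zeroʳ (suc (suc n))
Fpow-closed (suc n) (suc p)       l       = *-cancelˡ-≡ _ _ (suc n) (begin
  suc n * (suc (suc n) * Fpow (suc p) (suc (suc n)) l)
    ≡⟨ cong (λ t → suc n * (suc (suc n) * (Fpow p (suc n) l + Fpow (suc p) (suc n) l + t)))
            (y·-+ (Fpow (suc p) (suc n)) (Fpow (suc (suc p)) (suc n)) l) ⟩
  suc n * (suc (suc n) * ((Fpow p (suc n) l + Fpow (suc p) (suc n) l)
                          + (y· (Fpow (suc p) (suc n)) l + y· (Fpow (suc (suc p)) (suc n)) l)))
    ≡⟨ distribute (suc n) (Fpow p (suc n) l) (Fpow (suc p) (suc n) l)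
                  (y· (Fpow (suc p) (suc n)) l) (y· (Fpow (suc (suc p)) (suc n)) l) ⟩
  suc (suc n) * ((suc n * Fpow p (suc n) l + suc n * Fpow (suc p) (suc n) l)
                 + (suc n * y· (Fpow (suc p) (suc n)) l + suc n * y· (Fpow (suc (suc p)) (suc n)) l))
    ≡⟨ cong (suc (suc n) *_) (cong₂ _+_ (cong₂ _+_ (Fpow-closed n p l) (Fpow-closed n (suc p) l))
                                         (cong₂ _+_ (shifted p l) (shifted (suc p) l))) ⟩
  suc (suc n) * ((p * b * c + suc p * b * d) + (suc p * a * c + suc (suc p) * a * d))
    ≡⟨ closedForm-step (suc n) p l a b c d (trans (cong (l *_) (sym (pascal (suc n) l))) (absorption (suc n) l))
                                           (absorption (suc n) (suc (p + l))) ⟩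
  suc n * (suc p * (a + b) * (c + d))
    ≡⟨ cong (λ t → suc n * (suc p * t * (c + d))) (sym (pascal (suc n) l)) ⟩
  suc n * (suc p * binom (suc (suc n)) l * binom (suc (suc n)) (suc p + l)) ∎)
  where
  a b c d : ℕ
  a = y· (binom (suc n)) l
  b = binom (suc n) l
  c = binom (suc n) (p + l)
  d = binom (suc n) (suc (p + l))
  distribute : ∀ N x y z w → N * (suc N * ((x + y) + (z + w))) ≡ suc N * ((N * x + N * y) + (N * z + N * w))
  distribute = solve-∀
  shifted : ∀ m l → suc n * y· (Fpow (suc m) (suc n)) l ≡ suc m * y· (binom (suc n)) l * binom (suc n) (m + l)
  shifted m zero     = trans (*-zeroʳ (suc n)) (sym (cong (_* binom (suc n) (m + 0)) (*-zeroʳ (suc m))))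
  shifted m (suc l') =
    trans (Fpow-closed n (suc m) l') (cong (λ t → suc m * binom (suc n) l' * binom (suc n) t) (sym (+-suc m l')))

sum-concatMap : ∀ {B : Set} (g : B → List ℕ) xs → sum (concatMap g xs) ≡ sum (map (sum ∘ g) xs)
sum-concatMap g []       = refl
sum-concatMap g (x ∷ xs) = trans (sum-++ (g x) (concatMap g xs)) (cong (sum (g x) +_) (sum-concatMap g xs))

module _ {A : Set} where
  sum-map-*ˡ : ∀ c (f : A → ℕ) xs → sum (map (λ x → c * f x) xs) ≡ c * sum (map f xs)
  sum-map-*ˡ c f []       = sym (*-zeroʳ c)
  sum-map-*ˡ c f (x ∷ xs) = trans (cong (c * f x +_) (sum-map-*ˡ c f xs)) (sym (*-distribˡ-+ c (f x) _))

  sum-map-Σ< : ∀ m (f : A → ℕ → ℕ) xs → sum (map (λ x → Σ< m (f x)) xs) ≡ Σ< m (λ j → sum (map (λ x → f x j) xs))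
  sum-map-Σ< m f []       = sym (Σ<-zero m)
  sum-map-Σ< m f (x ∷ xs) =
    trans (cong (Σ< m (f x) +_) (sum-map-Σ< m f xs)) (sym (Σ<-+ m (f x) (λ j → sum (map (λ x → f x j) xs))))

  sum-map-concatMap : ∀ {B : Set} (F : A → ℕ) (g : B → List A) xs →
                      sum (map F (concatMap g xs)) ≡ sum (map (λ x → sum (map F (g x))) xs)
  sum-map-concatMap F g xs = trans (cong sum (map-concatMap F g xs)) (sum-concatMap (map F ∘ g) xs)

sum-map-applyUpTo : ∀ (f : ℕ → ℕ) (g : ℕ → ℕ) n → sum (map f (applyUpTo g n)) ≡ Σ< n (f ∘ g)
sum-map-applyUpTo f g zero    = refl
sum-map-applyUpTo f g (suc n) = cong (f (g 0) +_) (sum-map-applyUpTo f (g ∘ suc) n)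

sum-map-upTo : ∀ (f : ℕ → ℕ) n → sum (map f (upTo n)) ≡ Σ< n f
sum-map-upTo f = sum-map-applyUpTo f (λ i → i)

-- The summand of E, read in ℕ: Π_t [x^(i_t) y^(j_t)] F  (= Π_t N(i_t, j_t + 1)).
weight : List ℕ → List ℕ → ℕ
weight is js = product (zipWith (Fpow 1) is js)

weightSum : ℕ → List ℕ → ℕ → ℕ
weightSum p is l = sum (map (weight is) (weakCompositions p l))

compositionSum : ℕ → Series
compositionSum p n l = sum (map (λ is → weightSum p is l) (compositions p n))

weightSum-cons : ∀ p i is l → weightSum (suc p) (i ∷ is) l ≡ (Fpow 1 i ⋆ weightSum p is) l
weightSum-cons p i is l = begin
  sum (map (weight (i ∷ is)) (concatMap (λ j → map (j ∷_) (ws j)) (upTo (suc l))))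
    ≡⟨ sum-map-concatMap (weight (i ∷ is)) (λ j → map (j ∷_) (ws j)) (upTo (suc l)) ⟩
  sum (map (λ j → sum (map (weight (i ∷ is)) (map (j ∷_) (ws j)))) (upTo (suc l)))
    ≡⟨ cong sum (map-cong first-part (upTo (suc l))) ⟩
  sum (map (λ j → Fpow 1 i j * weightSum p is (l ∸ j)) (upTo (suc l)))
    ≡⟨ sum-map-upTo (λ j → Fpow 1 i j * weightSum p is (l ∸ j)) (suc l) ⟩
  (Fpow 1 i ⋆ weightSum p is) l ∎
  where
  ws : ℕ → List (List ℕ)
  ws j = weakCompositions p (l ∸ j)
  first-part : ∀ j → sum (map (weight (i ∷ is)) (map (j ∷_) (ws j))) ≡ Fpow 1 i j * weightSum p is (l ∸ j)
  first-part j = trans (cong sum (sym (map-∘ (ws j)))) (sum-map-*ˡ (Fpow 1 i j) (weight is) (ws j))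

-- Splitting off the first part i₀ of the composition is a Cauchy product in x
-- (the term i₀ = 0 vanishes, since F has no constant term).
compositionSum-suc : ∀ p n l → compositionSum (suc p) n l ≡ (Fpow 1 ⊛ compositionSum p) n l
compositionSum-suc p n l = begin
  sum (map F (concatMap (λ i → map (i ∷_) (cs i)) (map suc (upTo n))))
    ≡⟨ sum-map-concatMap F (λ i → map (i ∷_) (cs i)) (map suc (upTo n)) ⟩
  sum (map (λ i → sum (map F (map (i ∷_) (cs i)))) (map suc (upTo n)))
    ≡⟨ cong sum (sym (map-∘ (upTo n))) ⟩
  sum (map (λ i → sum (map F (map (suc i ∷_) (cs (suc i))))) (upTo n))
    ≡⟨ sum-map-upTo (λ i → sum (map F (map (suc i ∷_) (cs (suc i))))) n ⟩
  Σ< n (λ i → sum (map F (map (suc i ∷_) (cs (suc i)))))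
    ≡⟨ Σ<-cong n first-part ⟩
  Σ< n (λ i → (Fpow 1 (suc i) ⋆ compositionSum p (n ∸ suc i)) l)
    ≡⟨ cong (_+ Σ< n (λ i → (Fpow 1 (suc i) ⋆ compositionSum p (n ∸ suc i)) l)) (⋆-zeroˡ (compositionSum p n) l) ⟨
  (Fpow 1 ⊛ compositionSum p) n l ∎
  where
  F : List ℕ → ℕ
  F is = weightSum (suc p) is l
  cs : ℕ → List (List ℕ)
  cs i = compositions p (n ∸ i)
  first-part : ∀ i → sum (map F (map (suc i ∷_) (cs (suc i)))) ≡ (Fpow 1 (suc i) ⋆ compositionSum p (n ∸ suc i)) l
  first-part i = begin
    sum (map F (map (suc i ∷_) (cs (suc i))))
      ≡⟨ cong sum (sym (map-∘ (cs (suc i)))) ⟩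
    sum (map (λ is → weightSum (suc p) (suc i ∷ is) l) (cs (suc i)))
      ≡⟨ cong sum (map-cong (λ is → weightSum-cons p (suc i) is l) (cs (suc i))) ⟩
    sum (map (λ is → (Fpow 1 (suc i) ⋆ weightSum p is) l) (cs (suc i)))
      ≡⟨ sum-map-Σ< (suc l) (λ is j → Fpow 1 (suc i) j * weightSum p is (l ∸ j)) (cs (suc i)) ⟩
    Σ< (suc l) (λ j → sum (map (λ is → Fpow 1 (suc i) j * weightSum p is (l ∸ j)) (cs (suc i))))
      ≡⟨ Σ<-cong (suc l) (λ j → sum-map-*ˡ (Fpow 1 (suc i) j) (λ is → weightSum p is (l ∸ j)) (cs (suc i))) ⟩
    (Fpow 1 (suc i) ⋆ compositionSum p (n ∸ suc i)) l ∎

compositionSum-zero : ∀ n l → compositionSum 0 n l ≡ Fpow 0 n l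
compositionSum-zero zero    zero    = refl
compositionSum-zero zero    (suc l) = refl
compositionSum-zero (suc n) l       = refl

compositionSum≡Fpow : ∀ p n l → compositionSum p n l ≡ Fpow p n l
compositionSum≡Fpow zero    n l = compositionSum-zero n l
compositionSum≡Fpow (suc p) n l = begin
  compositionSum (suc p) n l         ≡⟨ compositionSum-suc p n l ⟩
  (Fpow 1 ⊛ compositionSum p) n l    ≡⟨ ⊛-congʳ (Fpow 1) n l (compositionSum≡Fpow p) ⟩
  (Fpow 1 ⊛ Fpow p) n l              ≡⟨ Fpow-⊛ 1 p n l ⟩
  Fpow (suc p) n l                   ∎

N≡Fpow₁ : ∀ i j → N i (suc j) ≡ ι (Fpow 1 i j)
N≡Fpow₁ zero    j = refl
N≡Fpow₁ (suc i) j = ι-/ i (Fpow 1 (suc i) j) _ (begin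
  (suc i C suc j) * (suc i C j)                     ≡⟨ cong₂ _*_ (binom≡C (suc i) (suc j)) (binom≡C (suc i) j) ⟨
  binom (suc i) (suc j) * binom (suc i) j           ≡⟨ *-comm (binom (suc i) (suc j)) (binom (suc i) j) ⟩
  binom (suc i) j * binom (suc i) (suc j)           ≡⟨ cong (_* binom (suc i) (suc j)) (*-identityˡ (binom (suc i) j)) ⟨
  1 * binom (suc i) j * binom (suc i) (1 + j)       ≡⟨ Fpow-closed i 1 j ⟨
  suc i * Fpow 1 (suc i) j                          ∎)

Nk≡Fpow : ∀ n k l → Nk k (suc n) (suc l) ≡ ι (Fpow (suc k) (suc n) l)
Nk≡Fpow n k l = ι-/ n (Fpow (suc k) (suc n) l) _ (begin
  suc k * (suc n C (suc l + k)) * (suc n C l)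
    ≡⟨ cong₂ (λ u v → suc k * u * v) (binom≡C (suc n) (suc l + k)) (binom≡C (suc n) l) ⟨
  suc k * binom (suc n) (suc l + k) * binom (suc n) l
    ≡⟨ cong (λ t → suc k * binom (suc n) (suc t) * binom (suc n) l) (+-comm l k) ⟩
  suc k * binom (suc n) (suc k + l) * binom (suc n) l
    ≡⟨ swap (suc k) (binom (suc n) (suc k + l)) (binom (suc n) l) ⟩
  suc k * binom (suc n) l * binom (suc n) (suc k + l)
    ≡⟨ Fpow-closed n (suc k) l ⟨
  suc n * Fpow (suc k) (suc n) l ∎)
  where
  swap : ∀ m x y → m * x * y ≡ m * y * x
  swap = solve-∀

weight-ι : ∀ is js → prodℚ (zipWith (λ i j → N i (suc j)) is js) ≡ ι (weight is js)
weight-ι []       js       = refl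
weight-ι (i ∷ is) []       = refl
weight-ι (i ∷ is) (j ∷ js) =
  trans (cong₂ ℚ._*_ (N≡Fpow₁ i j) (weight-ι is js)) (sym (ι-* (Fpow 1 i j) (weight is js)))

E≡ι : ∀ n k l → E n k l ≡ ι (compositionSum (suc k) n l)
E≡ι n k l = begin
  sumℚ (concatMap (λ is → map (λ js → prodℚ (zipWith (λ i j → N i (suc j)) is js)) ws) cs)
    ≡⟨ cong sumℚ (concatMap-cong (λ is → trans (map-cong (weight-ι is) ws) (map-∘ ws)) cs) ⟩
  sumℚ (concatMap (λ is → map ι (map (weight is) ws)) cs)
    ≡⟨ cong sumℚ (map-concatMap ι (λ is → map (weight is) ws) cs) ⟨
  sumℚ (map ι (concatMap (λ is → map (weight is) ws) cs))
    ≡⟨ ι-sum (concatMap (λ is → map (weight is) ws) cs) ⟩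
  ι (sum (concatMap (λ is → map (weight is) ws) cs))
    ≡⟨ cong ι (sum-concatMap (λ is → map (weight is) ws) cs) ⟩
  ι (compositionSum (suc k) n l) ∎
  where
  ws cs : List (List ℕ)
  ws = weakCompositions (suc k) l
  cs = compositions (suc k) n

lemma5 : (n k ℓ : ℕ) → .{{_ : NonZero n}} → E n k ℓ ≡ Nk k n (suc ℓ)
lemma5 (suc n) k ℓ = begin
  E (suc n) k ℓ                          ≡⟨ E≡ι (suc n) k ℓ ⟩
  ι (compositionSum (suc k) (suc n) ℓ)   ≡⟨ cong ι (compositionSum≡Fpow (suc k) (suc n) ℓ) ⟩
  ι (Fpow (suc k) (suc n) ℓ)             ≡⟨ Nk≡Fpow n k ℓ ⟨
  Nk k (suc n) (suc ℓ)                   ∎
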